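{- Let $G$ be a connected graph such that $\overline{G}$ is connected. Then $\mathrm{c}_m(G\overline{G})=\max\{\omega(G),\alpha(G)\}$.
   Context: All graphs are finite, simple and undirected. The complementary prism $G\overline{G}$ of a graph $G$ is obtained from the disjoint union of $G$ and its complement $\overline{G}$ by adding the edges of the perfect matching joining each vertex $u$ of $G$ to its copy $\overline{u}$ in $\overline{G}$. A path is monophonic if it is an induced (chordless) path. A set $S$ of vertices of a graph $H$ is monophonic convex if $S$ contains every vertex of every monophonic path between two vertices of $S$. The monophonic convexity number $\mathrm{c}_m(H)$ is the maximum cardinality of a proper (i.e. $\neq V(H)$) monophonic convex set of $H$. $\omega(G)$ is the clique number and $\alpha(G)$ the independence number of $G$. -}

module Defs where

open import Data.Bool using (Bool; true; false; not; _∧_; if_then_else_)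
open import Data.Nat using (ℕ; zero; suc; _≤_; _⊔_)
open import Data.Fin using (Fin)
open import Data.Sum using (_⊎_; inj₁; inj₂)
open import Data.List using (List; []; _∷_; _++_; map; length; filter; allFin)
open import Data.List.Membership.Propositional using (_∈_)
open import Data.List.Relation.Unary.All using (All)
open import Data.List.Relation.Unary.Unique.Propositional using (Unique)
open import Data.Product using (Σ; ∃; _×_; _,_)
open import Data.Empty using (⊥)
open import Relation.Binary.PropositionalEquality using (_≡_; _≢_)
open import Relation.Nullary using (¬_)
open import Data.Bool.Properties using (T?)
open import Data.Bool using (T)

-- Finiteness is supplied separately by an enumeration of V.

record Graph (V : Set) : Set where
  field
    adj   : V → V → Bool
    sym   : ∀ u v → adj u v ≡ adj v u
    irrefl : ∀ v → adj v v ≡ false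
open Graph public

VSet : Set → Set
VSet V = V → Bool

-- cardinality of a subset of a finite vertex set given by an
-- enumeration (a duplicate-free list of all vertices)
card : {V : Set} → List V → VSet V → ℕ
card vs S = length (filter (λ v → T? (S v)) vs)

Proper : {V : Set} → VSet V → Set
Proper {V} S = ∃ λ (v : V) → S v ≡ false

Walk : {V : Set} → Graph V → List V → Set
Walk G [] = ⊥
Walk G (x ∷ []) = Data.Unit.⊤ where import Data.Unit
Walk G (x ∷ y ∷ xs) = T (adj G x y) × Walk G (y ∷ xs)

data Ends {V : Set} : List V → V → V → Set where
  single : ∀ x → Ends (x ∷ []) x x
  cons   : ∀ x y ys z → Ends (y ∷ ys) y z → Ends (x ∷ y ∷ ys) x z

NoChord : {V : Set} → Graph V → List V → Set
NoChord G [] = Data.Unit.⊤ where import Data.Unit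
NoChord G (x ∷ []) = Data.Unit.⊤ where import Data.Unit
NoChord G (x ∷ y ∷ zs) = All (λ z → adj G x z ≡ false) zs × NoChord G (y ∷ zs)

MonophonicPath : {V : Set} → Graph V → V → V → List V → Set
MonophonicPath G u v p = Ends p u v × Walk G p × Unique p × NoChord G p

Connected : {V : Set} → Graph V → Set
Connected {V} G = ∀ (u v : V) → ∃ λ p → Ends p u v × Walk G p

MConvex : {V : Set} → Graph V → VSet V → Set
MConvex {V} G S = ∀ (u v : V) (p : List V) → S u ≡ true → S v ≡ true →
  MonophonicPath G u v p → All (λ w → S w ≡ true) p

Clique : {V : Set} → Graph V → VSet V → Set
Clique {V} G S = ∀ (u v : V) → S u ≡ true → S v ≡ true → u ≢ v → adj G u v ≡ true

Independent : {V : Set} → Graph V → VSet V → Set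
Independent {V} G S = ∀ (u v : V) → S u ≡ true → S v ≡ true → adj G u v ≡ false

IsMaxCard : {V : Set} → List V → (VSet V → Set) → ℕ → Set
IsMaxCard {V} vs P k = (∃ λ S → P S × card vs S ≡ k) × (∀ S → P S → card vs S ≤ k)

complement : {n : ℕ} → Graph (Fin n) → Graph (Fin n)
complement {n} G = record { adj = cadj ; sym = csym ; irrefl = cirr }
  where
  open import Data.Fin using (_≟_)
  open import Relation.Nullary using (yes; no)
  open import Relation.Binary.PropositionalEquality using (refl; sym; cong)
  cadj : Fin n → Fin n → Bool
  cadj u v with u ≟ v
  ... | yes _ = false
  ... | no _ = not (adj G u v)
  csym : ∀ u v → cadj u v ≡ cadj v u
  csym u v with u ≟ v | v ≟ u
  ... | yes _ | yes _ = refl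
  ... | yes refl | no q with () ← q refl
  ... | no q | yes refl with () ← q refl
  ... | no _ | no _ = cong not (Graph.sym G u v)
  cirr : ∀ v → cadj v v ≡ false
  cirr v with v ≟ v
  ... | yes _ = refl
  ... | no q with () ← q refl

eqᵇ : {n : ℕ} → Fin n → Fin n → Bool
eqᵇ u v = Relation.Nullary.Decidable.isYes (u Data.Fin.≟ v)
  where import Relation.Nullary.Decidable ; import Data.Fin

-- G Ḡ : vertex inj₁ u is u in G, vertex inj₂ u is its copy ū in Ḡ
prismAdj : {n : ℕ} → Graph (Fin n) → Fin n ⊎ Fin n → Fin n ⊎ Fin n → Bool
prismAdj G (inj₁ u) (inj₁ v) = adj G u v
prismAdj G (inj₂ u) (inj₂ v) = adj (complement G) u v
prismAdj G (inj₁ u) (inj₂ v) = eqᵇ u v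
prismAdj G (inj₂ u) (inj₁ v) = eqᵇ u v

complementaryPrism : {n : ℕ} → Graph (Fin n) → Graph (Fin n ⊎ Fin n)
complementaryPrism {n} G = record { adj = prismAdj G ; sym = psym ; irrefl = pirr }
  where
  open import Data.Fin using (_≟_)
  open import Relation.Nullary using (yes; no)
  open import Relation.Binary.PropositionalEquality using (refl)
  eqsym : ∀ (u v : Fin n) → eqᵇ u v ≡ eqᵇ v u
  eqsym u v with u ≟ v | v ≟ u
  ... | yes _ | yes _ = refl
  ... | yes refl | no q with () ← q refl
  ... | no q | yes refl with () ← q refl
  ... | no _ | no _ = refl
  psym : ∀ u v → prismAdj G u v ≡ prismAdj G v u
  psym (inj₁ u) (inj₁ v) = Graph.sym G u v
  psym (inj₂ u) (inj₂ v) = Graph.sym (complement G) u v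
  psym (inj₁ u) (inj₂ v) = eqsym u v
  psym (inj₂ u) (inj₁ v) = eqsym u v
  pirr : ∀ v → prismAdj G v v ≡ false
  pirr (inj₁ v) = Graph.irrefl G v
  pirr (inj₂ v) = Graph.irrefl (complement G) v

verticesG : (n : ℕ) → List (Fin n)
verticesG n = allFin n

verticesPrism : (n : ℕ) → List (Fin n ⊎ Fin n)
verticesPrism n = map inj₁ (allFin n) ++ map inj₂ (allFin n)

-- Split a proper monophonic convex set S of G Ḡ into A = S ∩ V(G) and
-- B = S ∩ V(Ḡ), and call x full when both x and x̄ lie in S. Short induced
-- paths through the perfect matching show: two non-adjacent vertices of A are
-- full, two vertices of B adjacent in G are full, and a vertex of A together
-- with a different vertex of B produce two distinct full vertices. When G and
-- Ḡ are connected there are no two distinct full vertices u, v: since S is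
-- proper, walks in G and in Ḡ leave the full vertices along edges whose outer
-- ends y₁ and y₀ are respectively adjacent and non-adjacent to every full
-- vertex, and an induced path through u, v, y₁, y₀ then forces y₁ or y₀ to be
-- full. Hence A is a clique of G, B an independent set of G, and if both are
-- non-empty then S = {x, x̄}; so |S| ≤ max(ω, α). Conversely a maximum clique
-- of G, or the copy in Ḡ of a maximum independent set, is a clique of G Ḡ and
-- therefore a proper convex set.
module Submission where

open import Defs hiding (sym)
open import Data.Bool using (Bool; T; true; false; not; _∨_) renaming (_≟_ to _≟ᵇ_)
open import Data.Bool.Properties using (T-≡; not-¬; ∨-zeroʳ)
open import Data.Empty using (⊥; ⊥-elim)
open import Data.Fin using (Fin; _≟_)
import Data.Fin as Fin
open import Data.List using (List; []; _∷_; _++_; map; allFin)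
open import Data.List.Membership.Propositional using (_∈_)
open import Data.List.Membership.Propositional.Properties using (∈-allFin)
open import Data.List.Relation.Unary.All as All using (All; []; _∷_)
open import Data.List.Relation.Unary.AllPairs using ([]; _∷_)
open import Data.List.Relation.Unary.Any using (here; there)
open import Data.List.Relation.Unary.Unique.Propositional using (Unique)
open import Data.List.Relation.Unary.Unique.Propositional.Properties using (allFin⁺)
open import Data.Nat using (ℕ; suc; _+_; _≤_; _⊔_; z≤n; s≤s; NonZero)
open import Data.Nat.Properties
  using (≤-trans; n≤1+n; +-mono-≤; +-identityʳ; m≤m⊔n; m≤n⊔m; ⊔-sel;
         module ≤-Reasoning)
open import Data.Product using (∃; ∃₂; _×_; _,_; proj₁; proj₂; swap)
open import Data.Sum using (_⊎_; inj₁; inj₂; [_,_]′)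
open import Data.Sum.Properties using (inj₁-injective; inj₂-injective)
open import Data.Unit using (tt)
open import Function using (_∘_; const)
open import Function.Bundles using (Equivalence)
open import Relation.Binary.PropositionalEquality
  using (_≡_; _≢_; refl; sym; trans; cong; cong₂; subst; ≢-sym; module ≡-Reasoning)
open import Relation.Nullary using (¬_; yes; no; _×-dec_)
open import Relation.Unary using (Decidable)

T⇒≡true : ∀ {b} → T b → b ≡ true
T⇒≡true = Equivalence.to T-≡

≡true⇒T : ∀ {b} → b ≡ true → T b
≡true⇒T = Equivalence.from T-≡

module _ {V : Set} where

  card-map : {W : Set} (f : W → V) (xs : List W) (S : VSet V) → card (map f xs) S ≡ card xs (S ∘ f)
  card-map f [] S = refl
  card-map f (x ∷ xs) S with S (f x)
  ... | true = cong suc (card-map f xs S)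
  ... | false = card-map f xs S

  card-++ : (xs ys : List V) (S : VSet V) → card (xs ++ ys) S ≡ card xs S + card ys S
  card-++ [] ys S = refl
  card-++ (x ∷ xs) ys S with S x
  ... | true = cong suc (card-++ xs ys S)
  ... | false = card-++ xs ys S

  card-empty : (xs : List V) (S : VSet V) → All (λ x → S x ≡ false) xs → card xs S ≡ 0
  card-empty [] S [] = refl
  card-empty (x ∷ xs) S (Sx ∷ Sxs) rewrite Sx = card-empty xs S Sxs

  card-const-false : (xs : List V) → card xs (const false) ≡ 0
  card-const-false xs = card-empty xs (const false) (All.universal (λ _ → refl) xs)

  card≡0⊎inhabited : (xs : List V) (S : VSet V) → card xs S ≡ 0 ⊎ ∃ λ x → S x ≡ true
  card≡0⊎inhabited [] S = inj₁ refl
  card≡0⊎inhabited (x ∷ xs) S with S x in Sx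
  ... | true = inj₂ (x , Sx)
  ... | false = card≡0⊎inhabited xs S

  card-≤1 : (xs : List V) (S : VSet V) (y : V) → Unique xs → (∀ x → S x ≡ true → x ≡ y) → card xs S ≤ 1
  card-≤1 [] S y [] S⊆y = z≤n
  card-≤1 (x ∷ xs) S y (x∉xs ∷ xs!) S⊆y with S x in Sx
  ... | false = card-≤1 xs S y xs! S⊆y
  ... | true = s≤s (subst (_≤ 0) (sym (card-empty xs S (All.map outside x∉xs))) z≤n)
    where
    outside : ∀ {z} → x ≢ z → S z ≡ false
    outside {z} x≢z with S z in Sz
    ... | false = refl
    ... | true = ⊥-elim (x≢z (trans (S⊆y x Sx) (sym (S⊆y z Sz))))

  ∈⇒1≤card : (xs : List V) (S : VSet V) {x : V} → x ∈ xs → S x ≡ true → 1 ≤ card xs S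
  ∈⇒1≤card (y ∷ xs) S (here refl) Sx rewrite Sx = s≤s z≤n
  ∈⇒1≤card (y ∷ xs) S (there x∈xs) Sx with S y
  ... | true = s≤s z≤n
  ... | false = ∈⇒1≤card xs S x∈xs Sx

  ∈⇒2≤card : (xs : List V) (S : VSet V) {x y : V} → x ∈ xs → y ∈ xs → x ≢ y →
             S x ≡ true → S y ≡ true → 2 ≤ card xs S
  ∈⇒2≤card (z ∷ xs) S (here refl) (here refl) x≢y _ _ = ⊥-elim (x≢y refl)
  ∈⇒2≤card (z ∷ xs) S (here refl) (there y∈xs) _ Sx Sy rewrite Sx = s≤s (∈⇒1≤card xs S y∈xs Sy)
  ∈⇒2≤card (z ∷ xs) S (there x∈xs) (here refl) _ Sx Sy rewrite Sy = s≤s (∈⇒1≤card xs S x∈xs Sx)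
  ∈⇒2≤card (z ∷ xs) S (there x∈xs) (there y∈xs) x≢y Sx Sy with S z
  ... | true = ≤-trans (∈⇒2≤card xs S x∈xs y∈xs x≢y Sx Sy) (n≤1+n _)
  ... | false = ∈⇒2≤card xs S x∈xs y∈xs x≢y Sx Sy

ends-last-∈ : ∀ {V : Set} {p : List V} {a b} → Ends p a b → b ∈ p
ends-last-∈ (single x) = here refl
ends-last-∈ (cons x y ys z ends) = there (ends-last-∈ ends)

module _ {V : Set} (H : Graph V) where

  adj-sym : ∀ {x y b} → adj H x y ≡ b → adj H y x ≡ b
  adj-sym {x} {y} xy = trans (Graph.sym H y x) xy

  adj⇒≢ : ∀ {x y} → adj H x y ≡ true → x ≢ y
  adj⇒≢ {x} x∼x refl = not-¬ x∼x (irrefl H x)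

  ∼≁⇒≢ : ∀ {x y z} → adj H x y ≡ true → adj H x z ≡ false → y ≢ z
  ∼≁⇒≢ x∼y x≁y refl = not-¬ x∼y x≁y

  convex-P₃ : ∀ {S a b c} → MConvex H S → S a ≡ true → S c ≡ true →
    adj H a b ≡ true → adj H b c ≡ true → adj H a c ≡ false → a ≢ c → S b ≡ true
  convex-P₃ {S} {a} {b} {c} convex Sa Sc ab bc ac a≢c
    with convex a c (a ∷ b ∷ c ∷ []) Sa Sc
      ( cons a b _ c (cons b c _ c (single c))
      , (≡true⇒T ab , ≡true⇒T bc , tt)
      , ((adj⇒≢ ab ∷ a≢c ∷ []) ∷ (adj⇒≢ bc ∷ []) ∷ [] ∷ [])
      , ((ac ∷ []) , ([] , tt)))
  ... | _ ∷ Sb ∷ _ = Sb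

  convex-P₄ : ∀ {S a b c d} → MConvex H S → S a ≡ true → S d ≡ true →
    adj H a b ≡ true → adj H b c ≡ true → adj H c d ≡ true →
    adj H a c ≡ false → adj H a d ≡ false → adj H b d ≡ false →
    a ≢ c → a ≢ d → b ≢ d → S b ≡ true × S c ≡ true
  convex-P₄ {S} {a} {b} {c} {d} convex Sa Sd ab bc cd ac ad bd a≢c a≢d b≢d
    with convex a d (a ∷ b ∷ c ∷ d ∷ []) Sa Sd
      ( cons a b _ d (cons b c _ d (cons c d _ d (single d)))
      , (≡true⇒T ab , ≡true⇒T bc , ≡true⇒T cd , tt)
      , ((adj⇒≢ ab ∷ a≢c ∷ a≢d ∷ []) ∷ (adj⇒≢ bc ∷ b≢d ∷ []) ∷ (adj⇒≢ cd ∷ []) ∷ [] ∷ [])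
      , ((ac ∷ ad ∷ []) , (bd ∷ []) , [] , tt))
  ... | _ ∷ Sb ∷ Sc ∷ _ = Sb , Sc

  convex-P₅ : ∀ {S a b c d e} → MConvex H S → S a ≡ true → S e ≡ true →
    adj H a b ≡ true → adj H b c ≡ true → adj H c d ≡ true → adj H d e ≡ true →
    adj H a c ≡ false → adj H a d ≡ false → adj H a e ≡ false →
    adj H b d ≡ false → adj H b e ≡ false → adj H c e ≡ false →
    a ≢ c → a ≢ d → a ≢ e → b ≢ d → b ≢ e → c ≢ e →
    S b ≡ true × S c ≡ true × S d ≡ true
  convex-P₅ {S} {a} {b} {c} {d} {e} convex Sa Se ab bc cd de ac ad ae bd be ce a≢c a≢d a≢e b≢d b≢e c≢e
    with convex a e (a ∷ b ∷ c ∷ d ∷ e ∷ []) Sa Se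
      ( cons a b _ e (cons b c _ e (cons c d _ e (cons d e _ e (single e))))
      , (≡true⇒T ab , ≡true⇒T bc , ≡true⇒T cd , ≡true⇒T de , tt)
      , ( (adj⇒≢ ab ∷ a≢c ∷ a≢d ∷ a≢e ∷ []) ∷ (adj⇒≢ bc ∷ b≢d ∷ b≢e ∷ []) ∷ (adj⇒≢ cd ∷ c≢e ∷ [])
        ∷ (adj⇒≢ de ∷ []) ∷ [] ∷ [])
      , ((ac ∷ ad ∷ ae ∷ []) , (bd ∷ be ∷ []) , (ce ∷ []) , [] , tt))
  ... | _ ∷ Sb ∷ Sc ∷ Sd ∷ _ = Sb , Sc , Sd

  -- A monophonic path with at least three vertices would contain a chord between its ends.
  clique⇒convex : ∀ {S} → Clique H S → MConvex H S
  clique⇒convex clique a b .(a ∷ []) Sa Sb (single .a , _) = Sa ∷ []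
  clique⇒convex clique a b .(a ∷ y ∷ []) Sa Sb (cons .a y [] .b (single .b) , _) = Sa ∷ Sb ∷ []
  clique⇒convex clique a b .(a ∷ y ∷ z ∷ zs) Sa Sb
    (cons .a y (z ∷ zs) .b (cons .y .z .zs .b ends) , _ , (a∉ ∷ _) , (a-no-chord , _))
    = ⊥-elim (not-¬ (clique a b Sa Sb (All.lookup a∉ (there b∈zs))) (All.lookup a-no-chord b∈zs))
    where
    b∈zs = ends-last-∈ ends

  walk-neighbour : ∀ {p a b} → Ends p a b → Walk H p → a ≢ b → ∃ λ w → adj H a w ≡ true
  walk-neighbour (single x) _ a≢b = ⊥-elim (a≢b refl)
  walk-neighbour (cons x y ys z _) (x∼y , _) _ = y , T⇒≡true x∼y

  walk-crossing : ∀ {P : V → Set} → Decidable P → ∀ {p a b} → Ends p a b → Walk H p → P a → ¬ P b →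
    ∃₂ λ x y → P x × ¬ P y × adj H x y ≡ true
  walk-crossing P? (single x) _ Pa ¬Pb = ⊥-elim (¬Pb Pa)
  walk-crossing P? (cons x y ys z ends) (x∼y , walk) Px ¬Pb with P? y
  ... | yes Py = walk-crossing P? ends walk Py ¬Pb
  ... | no ¬Py = x , y , Px , ¬Py , T⇒≡true x∼y

  connected⇒neighbour : Connected H → ∀ {a b} → a ≢ b → ∃ λ w → adj H a w ≡ true
  connected⇒neighbour conn {a} {b} a≢b with conn a b
  ... | _ , ends , walk = walk-neighbour ends walk a≢b

  connected⇒crossing : Connected H → ∀ {P : V → Set} → Decidable P → ∀ {a b} → P a → ¬ P b →
    ∃₂ λ x y → P x × ¬ P y × adj H x y ≡ true
  connected⇒crossing conn P? {a} {b} Pa ¬Pb with conn a b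
  ... | _ , ends , walk = walk-crossing P? ends walk Pa ¬Pb

module _ {n : ℕ} where

  eqᵇ-refl : (x : Fin n) → eqᵇ x x ≡ true
  eqᵇ-refl x with x ≟ x
  ... | yes _ = refl
  ... | no x≢x = ⊥-elim (x≢x refl)

  eqᵇ-≢ : ∀ {x y : Fin n} → x ≢ y → eqᵇ x y ≡ false
  eqᵇ-≢ {x} {y} x≢y with x ≟ y
  ... | yes x≡y = ⊥-elim (x≢y x≡y)
  ... | no _ = refl

  eqᵇ⇒≡ : ∀ {x y : Fin n} → eqᵇ x y ≡ true → x ≡ y
  eqᵇ⇒≡ {x} {y} eq with x ≟ y
  ... | yes x≡y = x≡y

  complement-adj : (G : Graph (Fin n)) {x y : Fin n} → x ≢ y → adj (complement G) x y ≡ not (adj G x y)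
  complement-adj G {x} {y} x≢y with x ≟ y
  ... | yes x≡y = ⊥-elim (x≢y x≡y)
  ... | no _ = refl

  pair : Fin n → Fin n → VSet (Fin n)
  pair x y v = eqᵇ x v ∨ eqᵇ y v

  pair-cases : ∀ x y {v} → pair x y v ≡ true → v ≡ x ⊎ v ≡ y
  pair-cases x y {v} xyv with eqᵇ x v in xv
  ... | true = inj₁ (sym (eqᵇ⇒≡ xv))
  ... | false = inj₂ (sym (eqᵇ⇒≡ xyv))

  2≤card-pair : ∀ {x y : Fin n} → x ≢ y → 2 ≤ card (allFin n) (pair x y)
  2≤card-pair {x} {y} x≢y = ∈⇒2≤card (allFin n) (pair x y) (∈-allFin x) (∈-allFin y) x≢y
    (cong (_∨ eqᵇ y x) (eqᵇ-refl x)) (trans (cong (eqᵇ x y ∨_) (eqᵇ-refl y)) (∨-zeroʳ _))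

  -- Two distinct vertices form either a clique or an independent set.
  2≤ω⊔α : (G : Graph (Fin n)) {x y : Fin n} → x ≢ y → ∀ {ω α} →
    IsMaxCard (verticesG n) (Clique G) ω → IsMaxCard (verticesG n) (Independent G) α → 2 ≤ ω ⊔ α
  2≤ω⊔α G {x} {y} x≢y {ω} {α} (_ , max-clique) (_ , max-independent) with adj G x y in x?y
  ... | true = ≤-trans (2≤card-pair x≢y) (≤-trans (max-clique (pair x y) xy-clique) (m≤m⊔n ω α))
    where
    xy-clique : Clique G (pair x y)
    xy-clique a b a∈ b∈ a≢b with pair-cases x y a∈ | pair-cases x y b∈
    ... | inj₁ refl | inj₁ refl = ⊥-elim (a≢b refl)
    ... | inj₁ refl | inj₂ refl = x?y
    ... | inj₂ refl | inj₁ refl = adj-sym G x?y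
    ... | inj₂ refl | inj₂ refl = ⊥-elim (a≢b refl)
  ... | false = ≤-trans (2≤card-pair x≢y) (≤-trans (max-independent (pair x y) xy-independent) (m≤n⊔m ω α))
    where
    xy-independent : Independent G (pair x y)
    xy-independent a b a∈ b∈ with pair-cases x y a∈ | pair-cases x y b∈
    ... | inj₁ refl | inj₁ refl = irrefl G x
    ... | inj₁ refl | inj₂ refl = x?y
    ... | inj₂ refl | inj₁ refl = adj-sym G x?y
    ... | inj₂ refl | inj₂ refl = irrefl G y

  card-prism : (S : VSet (Fin n ⊎ Fin n)) →
    card (verticesPrism n) S ≡ card (allFin n) (S ∘ inj₁) + card (allFin n) (S ∘ inj₂)
  card-prism S = trans (card-++ (map inj₁ (allFin n)) (map inj₂ (allFin n)) S)
    (cong₂ _+_ (card-map inj₁ (allFin n) S) (card-map inj₂ (allFin n) S))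

module Prism {n : ℕ} (G : Graph (Fin n)) where

  H : Graph (Fin n ⊎ Fin n)
  H = complementaryPrism G

  Ḡ : Graph (Fin n)
  Ḡ = complement G

  ≁⇒adj-Ḡ : ∀ {x y} → x ≢ y → adj G x y ≡ false → adj Ḡ x y ≡ true
  ≁⇒adj-Ḡ x≢y x≁y = trans (complement-adj G x≢y) (cong not x≁y)

  ∼⇒¬adj-Ḡ : ∀ {x y} → adj G x y ≡ true → adj Ḡ x y ≡ false
  ∼⇒¬adj-Ḡ x∼y = trans (complement-adj G (adj⇒≢ G x∼y)) (cong not x∼y)

  adj-Ḡ⇒≁ : ∀ {x y} → adj Ḡ x y ≡ true → adj G x y ≡ false
  adj-Ḡ⇒≁ {x} {y} x∼ᶜy with adj G x y in x?y
  ... | false = refl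
  ... | true = ⊥-elim (not-¬ x∼ᶜy (∼⇒¬adj-Ḡ x?y))

  inj₁-≢ : ∀ {x y : Fin n} → x ≢ y → _≢_ {A = Fin n ⊎ Fin n} (inj₁ x) (inj₁ y)
  inj₁-≢ x≢y = x≢y ∘ inj₁-injective

  inj₂-≢ : ∀ {x y : Fin n} → x ≢ y → _≢_ {A = Fin n ⊎ Fin n} (inj₂ x) (inj₂ y)
  inj₂-≢ x≢y = x≢y ∘ inj₂-injective

  clique-copy : ∀ {K} → Clique G K → Clique H [ K , const false ]′
  clique-copy K-clique (inj₁ a) (inj₁ b) Ka Kb a≢b = K-clique a b Ka Kb (a≢b ∘ cong inj₁)

  independent-copy : ∀ {I} → Independent G I → Clique H [ const false , I ]′
  independent-copy I-independent (inj₂ a) (inj₂ b) Ia Ib a≢b =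
    ≁⇒adj-Ḡ (a≢b ∘ cong inj₂) (I-independent a b Ia Ib)

  card-inj₁-copy : (K : VSet (Fin n)) → card (verticesPrism n) [ K , const false ]′ ≡ card (allFin n) K
  card-inj₁-copy K = begin
    card (verticesPrism n) [ K , const false ]′ ≡⟨ card-prism [ K , const false ]′ ⟩
    card (allFin n) K + card (allFin n) (const false) ≡⟨ cong (card (allFin n) K +_) (card-const-false (allFin n)) ⟩
    card (allFin n) K + 0 ≡⟨ +-identityʳ _ ⟩
    card (allFin n) K ∎
    where open ≡-Reasoning

  card-inj₂-copy : (I : VSet (Fin n)) → card (verticesPrism n) [ const false , I ]′ ≡ card (allFin n) I
  card-inj₂-copy I = trans (card-prism [ const false , I ]′) (cong (_+ card (allFin n) I) (card-const-false (allFin n)))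

  module Convex (S : VSet (Fin n ⊎ Fin n)) (convex : MConvex H S) where

    A B : Fin n → Bool
    A = S ∘ inj₁
    B = S ∘ inj₂

    Full : Fin n → Set
    Full x = A x ≡ true × B x ≡ true

    full? : Decidable Full
    full? x = (A x ≟ᵇ true) ×-dec (B x ≟ᵇ true)

    ¬full-≢ : ∀ {x y} → ¬ Full y → Full x → y ≢ x
    ¬full-≢ ¬Fy Fx refl = ¬Fy Fx

    -- In the names below ∼ and ≁ refer to adjacency in G; each lemma applies
    -- convexity to the induced path of G Ḡ listed in its implicit arguments.

    A≁A⇒full : ∀ {u v} → A u ≡ true → A v ≡ true → adj G u v ≡ false → u ≢ v → Full u × Full v
    A≁A⇒full {u} {v} Au Av u≁v u≢v = (Au , proj₁ B-pair) , (Av , proj₂ B-pair)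
      where
      B-pair = convex-P₄ H {a = inj₁ u} {inj₂ u} {inj₂ v} {inj₁ v} convex Au Av
                 (eqᵇ-refl u) (≁⇒adj-Ḡ u≢v u≁v) (eqᵇ-refl v) (eqᵇ-≢ u≢v) u≁v (eqᵇ-≢ u≢v)
                 (λ ()) (inj₁-≢ u≢v) (λ ())

    B∼B⇒full : ∀ {u v} → B u ≡ true → B v ≡ true → adj G u v ≡ true → Full u × Full v
    B∼B⇒full {u} {v} Bu Bv u∼v = (proj₁ A-pair , Bu) , (proj₂ A-pair , Bv)
      where
      u≢v = adj⇒≢ G u∼v
      A-pair = convex-P₄ H {a = inj₂ u} {inj₁ u} {inj₁ v} {inj₂ v} convex Bu Bv
                 (eqᵇ-refl u) u∼v (eqᵇ-refl v) (eqᵇ-≢ u≢v) (∼⇒¬adj-Ḡ u∼v) (eqᵇ-≢ u≢v)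
                 (λ ()) (inj₂-≢ u≢v) (λ ())

    A≁B⇒B : ∀ {x y} → A x ≡ true → B y ≡ true → adj G x y ≡ false → x ≢ y → B x ≡ true
    A≁B⇒B {x} {y} Ax By x≁y x≢y =
      convex-P₃ H {a = inj₁ x} {inj₂ x} {inj₂ y} convex Ax By
        (eqᵇ-refl x) (≁⇒adj-Ḡ x≢y x≁y) (eqᵇ-≢ x≢y) (λ ())

    A∼B⇒A : ∀ {x y} → A x ≡ true → B y ≡ true → adj G x y ≡ true → A y ≡ true
    A∼B⇒A {x} {y} Ax By x∼y =
      convex-P₃ H {a = inj₁ x} {inj₁ y} {inj₂ y} convex Ax By
        x∼y (eqᵇ-refl y) (eqᵇ-≢ (adj⇒≢ G x∼y)) (λ ())

    A∼y≁B⇒full : ∀ {a c y} → A a ≡ true → B c ≡ true → adj G a y ≡ true → adj G c y ≡ false →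
                 a ≢ c → y ≢ a → y ≢ c → Full y
    A∼y≁B⇒full {a} {c} {y} Aa Bc a∼y c≁y a≢c y≢a y≢c =
      convex-P₄ H {a = inj₁ a} {inj₁ y} {inj₂ y} {inj₂ c} convex Aa Bc
        a∼y (eqᵇ-refl y) (≁⇒adj-Ḡ y≢c (adj-sym G c≁y)) (eqᵇ-≢ (≢-sym y≢a)) (eqᵇ-≢ a≢c) (eqᵇ-≢ y≢c)
        (λ ()) (λ ()) (λ ())

    A≁B⇒full-pair : Connected G → ∀ {x y} → A x ≡ true → B y ≡ true → adj G x y ≡ false → x ≢ y →
                    ∃₂ λ u v → Full u × Full v × u ≢ v
    A≁B⇒full-pair cG {x} {y} Ax By x≁y x≢y with A≁B⇒B Ax By x≁y x≢y | connected⇒neighbour G cG x≢y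
    ... | Bx | w , x∼w with adj G w y in w?y
    ...   | false = w , x , A∼y≁B⇒full Ax By x∼w (adj-sym G w?y) x≢y w≢x (∼≁⇒≢ G x∼w x≁y) , (Ax , Bx) , w≢x
      where w≢x = ≢-sym (adj⇒≢ G x∼w)
    ...   | true = x , y , (Ax , Bx) , (Ay , By) , x≢y
      where
      Ay = proj₂ (convex-P₄ H {a = inj₁ x} {inj₁ w} {inj₁ y} {inj₂ y} convex Ax By
             x∼w w?y (eqᵇ-refl y) x≁y (eqᵇ-≢ x≢y) (eqᵇ-≢ (adj⇒≢ G w?y)) (inj₁-≢ x≢y) (λ ()) (λ ()))

    A∼B⇒full-pair : Connected Ḡ → ∀ {x y} → A x ≡ true → B y ≡ true → adj G x y ≡ true →
                    ∃₂ λ u v → Full u × Full v × u ≢ v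
    A∼B⇒full-pair cḠ {x} {y} Ax By x∼y with A∼B⇒A Ax By x∼y | connected⇒neighbour Ḡ cḠ y≢x
      where y≢x = ≢-sym (adj⇒≢ G x∼y)
    ... | Ay | w , y∼ᶜw with adj G x w in x?w
    ...   | true = w , y , Fw , (Ay , By) , ≢-sym y≢w
      where
      y≢w = adj⇒≢ Ḡ y∼ᶜw
      Fw = swap (convex-P₄ H {a = inj₂ y} {inj₂ w} {inj₁ w} {inj₁ x} convex By Ax
             y∼ᶜw (eqᵇ-refl w) (adj-sym G x?w) (eqᵇ-≢ y≢w) (eqᵇ-≢ (≢-sym (adj⇒≢ G x∼y)))
             (eqᵇ-≢ (≢-sym (adj⇒≢ G x?w))) (λ ()) (λ ()) (λ ()))
    ...   | false = x , y , (Ax , Bx) , (Ay , By) , adj⇒≢ G x∼y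
      where
      y≢x = ≢-sym (adj⇒≢ G x∼y)
      w≢x = ≢-sym (∼≁⇒≢ G (adj-sym G x∼y) (adj-Ḡ⇒≁ y∼ᶜw))
      Bx = proj₂ (convex-P₄ H {a = inj₂ y} {inj₂ w} {inj₂ x} {inj₁ x} convex By Ax
             y∼ᶜw (≁⇒adj-Ḡ w≢x (adj-sym G x?w)) (eqᵇ-refl x) (∼⇒¬adj-Ḡ (adj-sym G x∼y))
             (eqᵇ-≢ y≢x) (eqᵇ-≢ w≢x) (inj₂-≢ y≢x) (λ ()) (λ ()))

    A-B⇒full-pair : Connected G → Connected Ḡ → ∀ {x y} → A x ≡ true → B y ≡ true → x ≢ y →
                    ∃₂ λ u v → Full u × Full v × u ≢ v
    A-B⇒full-pair cG cḠ {x} {y} Ax By x≢y with adj G x y in x?y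
    ... | false = A≁B⇒full-pair cG Ax By x?y x≢y
    ... | true = A∼B⇒full-pair cḠ Ax By x?y

    full∼¬full⇒common : ∀ {x z y} → Full x → Full z → adj G x y ≡ true → ¬ Full y → adj G z y ≡ true
    full∼¬full⇒common {x} {z} {y} Fx Fz x∼y ¬Fy with adj G z y in z?y
    ... | true = refl
    ... | false = ⊥-elim (¬Fy (A∼y≁B⇒full (proj₁ Fx) (proj₂ Fz) x∼y z?y
                    (∼≁⇒≢ G (adj-sym G x∼y) (adj-sym G z?y)) (¬full-≢ ¬Fy Fx) (¬full-≢ ¬Fy Fz)))

    full≁¬full⇒common : ∀ {x z y} → Full x → Full z → adj G x y ≡ false → ¬ Full y → adj G z y ≡ false
    full≁¬full⇒common {x} {z} {y} Fx Fz x≁y ¬Fy with adj G z y in z?y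
    ... | false = refl
    ... | true = ⊥-elim (¬Fy (A∼y≁B⇒full (proj₁ Fz) (proj₂ Fx) z?y x≁y
                    (∼≁⇒≢ G (adj-sym G z?y) (adj-sym G x≁y)) (¬full-≢ ¬Fy Fz) (¬full-≢ ¬Fy Fx)))

    nonadjacent-full-pair-separated⇒⊥ : ∀ {u v y₁ y₀} → Full u → Full v → u ≢ v → adj G u v ≡ false →
      ¬ Full y₁ → adj G u y₁ ≡ true → adj G v y₁ ≡ true →
      ¬ Full y₀ → adj G u y₀ ≡ false → adj G v y₀ ≡ false → ⊥
    nonadjacent-full-pair-separated⇒⊥ {u} {v} {y₁} {y₀} (Au , Bu) (Av , Bv) u≢v u≁v
      ¬Fy₁ u∼y₁ v∼y₁ ¬Fy₀ u≁y₀ v≁y₀ with adj G y₁ y₀ in y₁?y₀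
    ... | true = ¬Fy₀ (proj₂
          (convex-P₅ H {a = inj₁ u} {inj₁ y₁} {inj₁ y₀} {inj₂ y₀} {inj₂ v} convex Au Bv
            u∼y₁ y₁?y₀ (eqᵇ-refl y₀) (≁⇒adj-Ḡ y₀≢v (adj-sym G v≁y₀)) u≁y₀
            (eqᵇ-≢ (≢-sym y₀≢u)) (eqᵇ-≢ u≢v) (eqᵇ-≢ y₁≢y₀) (eqᵇ-≢ y₁≢v) (eqᵇ-≢ y₀≢v)
            (inj₁-≢ (≢-sym y₀≢u)) (λ ()) (λ ()) (λ ()) (λ ()) (λ ())))
      where
      y₀≢u = ¬full-≢ ¬Fy₀ (Au , Bu)
      y₀≢v = ¬full-≢ ¬Fy₀ (Av , Bv)
      y₁≢y₀ = ∼≁⇒≢ G u∼y₁ u≁y₀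
      y₁≢v = ¬full-≢ ¬Fy₁ (Av , Bv)
    ... | false = ¬Fy₁ (Ay₁ , proj₁
          (convex-P₄ H {a = inj₁ y₁} {inj₂ y₁} {inj₂ y₀} {inj₂ u} convex Ay₁ Bu
            (eqᵇ-refl y₁) (≁⇒adj-Ḡ y₁≢y₀ y₁?y₀) (≁⇒adj-Ḡ y₀≢u (adj-sym G u≁y₀))
            (eqᵇ-≢ y₁≢y₀) (eqᵇ-≢ y₁≢u) (∼⇒¬adj-Ḡ (adj-sym G u∼y₁)) (λ ()) (λ ()) (inj₂-≢ y₁≢u)))
      where
      Ay₁ = convex-P₃ H {a = inj₁ u} {inj₁ y₁} {inj₁ v} convex Au Av u∼y₁ (adj-sym G v∼y₁) u≁v (inj₁-≢ u≢v)
      y₁≢y₀ = ∼≁⇒≢ G u∼y₁ u≁y₀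
      y₁≢u = ¬full-≢ ¬Fy₁ (Au , Bu)
      y₀≢u = ¬full-≢ ¬Fy₀ (Au , Bu)

    adjacent-full-pair-separated⇒⊥ : ∀ {u v y₁ y₀} → Full u → Full v → adj G u v ≡ true →
      ¬ Full y₁ → adj G u y₁ ≡ true → adj G v y₁ ≡ true →
      ¬ Full y₀ → adj G u y₀ ≡ false → adj G v y₀ ≡ false → ⊥
    adjacent-full-pair-separated⇒⊥ {u} {v} {y₁} {y₀} (Au , Bu) (Av , Bv) u∼v
      ¬Fy₁ u∼y₁ v∼y₁ ¬Fy₀ u≁y₀ v≁y₀ with adj G y₁ y₀ in y₁?y₀
    ... | false = ¬Fy₁ (swap (proj₂
          (convex-P₅ H {a = inj₂ u} {inj₂ y₀} {inj₂ y₁} {inj₁ y₁} {inj₁ v} convex Bu Av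
            (≁⇒adj-Ḡ (≢-sym y₀≢u) u≁y₀) (≁⇒adj-Ḡ (≢-sym y₁≢y₀) (adj-sym G y₁?y₀))
            (eqᵇ-refl y₁) (adj-sym G v∼y₁)
            (∼⇒¬adj-Ḡ u∼y₁) (eqᵇ-≢ (≢-sym y₁≢u)) (eqᵇ-≢ (adj⇒≢ G u∼v)) (eqᵇ-≢ (≢-sym y₁≢y₀))
            (eqᵇ-≢ y₀≢v) (eqᵇ-≢ y₁≢v)
            (inj₂-≢ (≢-sym y₁≢u)) (λ ()) (λ ()) (λ ()) (λ ()) (λ ()))))
      where
      y₀≢u = ¬full-≢ ¬Fy₀ (Au , Bu)
      y₀≢v = ¬full-≢ ¬Fy₀ (Av , Bv)
      y₁≢y₀ = ∼≁⇒≢ G u∼y₁ u≁y₀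
      y₁≢u = ¬full-≢ ¬Fy₁ (Au , Bu)
      y₁≢v = ¬full-≢ ¬Fy₁ (Av , Bv)
    ... | true = ¬Fy₀ (proj₁
          (convex-P₄ H {a = inj₂ y₀} {inj₁ y₀} {inj₁ y₁} {inj₁ u} convex By₀ Au
            (eqᵇ-refl y₀) (adj-sym G y₁?y₀) (adj-sym G u∼y₁)
            (eqᵇ-≢ (≢-sym (∼≁⇒≢ G u∼y₁ u≁y₀))) (eqᵇ-≢ y₀≢u) (adj-sym G u≁y₀)
            (λ ()) (λ ()) (inj₁-≢ y₀≢u)) , By₀)
      where
      y₀≢u = ¬full-≢ ¬Fy₀ (Au , Bu)
      By₀ = convex-P₃ H {a = inj₂ u} {inj₂ y₀} {inj₂ v} convex Bu Bv
              (≁⇒adj-Ḡ (≢-sym y₀≢u) u≁y₀) (≁⇒adj-Ḡ (¬full-≢ ¬Fy₀ (Av , Bv)) (adj-sym G v≁y₀))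
              (∼⇒¬adj-Ḡ u∼v) (inj₂-≢ (adj⇒≢ G u∼v))

    full-pair-separated⇒⊥ : ∀ {u v y₁ y₀} → Full u → Full v → u ≢ v →
      ¬ Full y₁ → adj G u y₁ ≡ true → adj G v y₁ ≡ true →
      ¬ Full y₀ → adj G u y₀ ≡ false → adj G v y₀ ≡ false → ⊥
    full-pair-separated⇒⊥ {u} {v} Fu Fv u≢v with adj G u v in u?v
    ... | false = nonadjacent-full-pair-separated⇒⊥ Fu Fv u≢v u?v
    ... | true = adjacent-full-pair-separated⇒⊥ Fu Fv u?v

    proper⇒¬full : Proper S → ∃ λ w → ¬ Full w
    proper⇒¬full (inj₁ w , Aw≡false) = w , λ (Aw , _) → not-¬ Aw Aw≡false
    proper⇒¬full (inj₂ w , Bw≡false) = w , λ (_ , Bw) → not-¬ Bw Bw≡false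

    full-unique : Connected G → Connected Ḡ → Proper S → ∀ {u v} → Full u → Full v → u ≡ v
    full-unique cG cḠ proper {u} {v} Fu Fv with u ≟ v | proper⇒¬full proper
    ... | yes u≡v | _ = u≡v
    ... | no u≢v | w , ¬Fw
      with connected⇒crossing G cG full? Fu ¬Fw | connected⇒crossing Ḡ cḠ full? Fu ¬Fw
    ... | x₁ , y₁ , Fx₁ , ¬Fy₁ , x₁∼y₁ | x₀ , y₀ , Fx₀ , ¬Fy₀ , x₀∼ᶜy₀ =
      ⊥-elim (full-pair-separated⇒⊥ Fu Fv u≢v
        ¬Fy₁ (full∼¬full⇒common Fx₁ Fu x₁∼y₁ ¬Fy₁) (full∼¬full⇒common Fx₁ Fv x₁∼y₁ ¬Fy₁)
        ¬Fy₀ (full≁¬full⇒common Fx₀ Fu x₀≁y₀ ¬Fy₀) (full≁¬full⇒common Fx₀ Fv x₀≁y₀ ¬Fy₀))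
      where x₀≁y₀ = adj-Ḡ⇒≁ x₀∼ᶜy₀

    module _ (cG : Connected G) (cḠ : Connected Ḡ) (proper : Proper S) where

      A-B⇒≡ : ∀ {x y} → A x ≡ true → B y ≡ true → x ≡ y
      A-B⇒≡ {x} {y} Ax By with x ≟ y
      ... | yes x≡y = x≡y
      ... | no x≢y with A-B⇒full-pair cG cḠ Ax By x≢y
      ...   | u , v , Fu , Fv , u≢v = ⊥-elim (u≢v (full-unique cG cḠ proper Fu Fv))

      A-clique : Clique G A
      A-clique u v Au Av u≢v with adj G u v in u?v
      ... | true = refl
      ... | false with A≁A⇒full Au Av u?v u≢v
      ...   | Fu , Fv = ⊥-elim (u≢v (full-unique cG cḠ proper Fu Fv))

      B-independent : Independent G B
      B-independent u v Bu Bv with adj G u v in u?v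
      ... | false = refl
      ... | true with B∼B⇒full Bu Bv u?v
      ...   | Fu , Fv = ⊥-elim (adj⇒≢ G u?v (full-unique cG cḠ proper Fu Fv))

      card≤ω⊔α : ∀ {ω α} → IsMaxCard (verticesG n) (Clique G) ω → IsMaxCard (verticesG n) (Independent G) α →
                 card (verticesPrism n) S ≤ ω ⊔ α
      card≤ω⊔α {ω} {α} hω hα rewrite card-prism S
        with card≡0⊎inhabited (allFin n) A | card≡0⊎inhabited (allFin n) B
      ... | inj₁ |A|≡0 | _ rewrite |A|≡0 = ≤-trans (proj₂ hα B B-independent) (m≤n⊔m ω α)
      ... | inj₂ _ | inj₁ |B|≡0 rewrite |B|≡0 | +-identityʳ (card (allFin n) A) =
        ≤-trans (proj₂ hω A A-clique) (m≤m⊔n ω α)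
      ... | inj₂ (x , Ax) | inj₂ (y , By) = begin
        card (allFin n) A + card (allFin n) B
          ≤⟨ +-mono-≤ (card-≤1 (allFin n) A y (allFin⁺ n) (λ x′ Ax′ → A-B⇒≡ Ax′ By))
                      (card-≤1 (allFin n) B x (allFin⁺ n) (λ y′ By′ → sym (A-B⇒≡ Ax By′))) ⟩
        2
          ≤⟨ 2≤ω⊔α G (≢-sym (¬full-≢ ¬Fw Fx)) hω hα ⟩
        ω ⊔ α ∎
        where
        open ≤-Reasoning
        Fx : Full x
        Fx = Ax , subst (λ t → B t ≡ true) (sym (A-B⇒≡ Ax By)) By
        ¬Fw = proj₂ (proper⇒¬full proper)

theorem3p1 : (n : ℕ) → .{{NonZero n}} → (G : Graph (Fin n)) →
    Connected G → Connected (complement G) →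
    (ω α : ℕ) →
    IsMaxCard (verticesG n) (Clique G) ω →
    IsMaxCard (verticesG n) (Independent G) α →
    IsMaxCard (verticesPrism n)
    (λ S → Proper S × MConvex (complementaryPrism G) S) (ω ⊔ α)
theorem3p1 n@(suc _) G cG cḠ ω α hω@((K , K-clique , |K|) , _) hα@((I , I-independent , |I|) , _) =
  max-attained , λ S (proper , convex) → Convex.card≤ω⊔α S convex cG cḠ proper hω hα
  where
  open Prism G
  max-attained : ∃ λ S → (Proper S × MConvex H S) × card (verticesPrism n) S ≡ ω ⊔ α
  max-attained with ⊔-sel ω α
  ... | inj₁ ω⊔α≡ω = [ K , const false ]′
                   , ((inj₂ Fin.zero , refl) , clique⇒convex H (clique-copy K-clique))
                   , trans (trans (card-inj₁-copy K) |K|) (sym ω⊔α≡ω)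
  ... | inj₂ ω⊔α≡α = [ const false , I ]′
                   , ((inj₁ Fin.zero , refl) , clique⇒convex H (independent-copy I-independent))
                   , trans (trans (card-inj₂-copy I) |I|) (sym ω⊔α≡α)
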